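{- For any positive integers $n,p,t$, any family $\mathcal{A}\subset2^{[n]}$ and any $t$-intersecting family $\mathcal{S}\subset\binom{[n]}{\le p}$, there exists a $t$-intersecting family $\mathcal{T}\subset\binom{[n]}{\le p}$ such that $\mathcal{A}[\mathcal{S}]\subset\mathcal{A}[\mathcal{T}]$ and for every $T\in\mathcal{T}$ and every proper subset $X\subsetneq T$ there exists $T'\in\mathcal{T}$ with $|X\cap T'|<t$.
   Context: $\binom{[n]}{\le p}$ is the family of subsets of $[n]$ of size at most $p$. For $X\subset[n]$, $\mathcal{A}[X]=\{A\in\mathcal{A}: X\subset A\}$ and $\mathcal{A}[\mathcal{S}]=\bigcup_{S\in\mathcal{S}}\mathcal{A}[S]$. A family is $t$-intersecting if any two (not necessarily distinct) members share at least $t$ elements. -}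

module Defs where

open import Data.Nat using (ℕ; _≤_; _<_)
open import Data.Fin.Subset using (Subset; _⊆_; _∩_; ∣_∣)
open import Data.List using (List)
open import Data.List.Membership.Propositional using (_∈_)
open import Data.Product using (_×_; ∃-syntax)
open import Relation.Binary.PropositionalEquality using (_≢_)

Family : ℕ → Set
Family n = List (Subset n)

-- t-intersecting: any two (not necessarily distinct) members share ≥ t elements.
IsTIntersecting : ∀ {n} → ℕ → Family n → Set
IsTIntersecting t 𝒮 = ∀ {F G} → F ∈ 𝒮 → G ∈ 𝒮 → t ≤ ∣ F ∩ G ∣

AllOfSizeAtMost : ∀ {n} → ℕ → Family n → Set
AllOfSizeAtMost p 𝒮 = ∀ {F} → F ∈ 𝒮 → ∣ F ∣ ≤ p

_∈[_]_ : ∀ {n} → Subset n → Family n → Family n → Set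
A ∈[ 𝒮 ] 𝒜 = A ∈ 𝒜 × ∃[ S ] (S ∈ 𝒮 × S ⊆ A)

SubTrace : ∀ {n} → Family n → Family n → Family n → Set
SubTrace 𝒜 𝒮 𝒯 = ∀ {A} → A ∈[ 𝒮 ] 𝒜 → A ∈[ 𝒯 ] 𝒜

_⊊_ : ∀ {n} → Subset n → Subset n → Set
X ⊊ T = X ⊆ T × X ≢ T

{-# OPTIONS --safe #-}
module Submission where

-- While some T ∈ 𝒯 has a proper subset X meeting every member of 𝒯 in at least t
-- elements, replace T by X.  The family stays t-intersecting (|X ∩ X| ≥ |X ∩ T| ≥ t),
-- its members only shrink, so sizes stay ≤ p and every A ⊇ T still contains X, and the
-- total size ∑ |T| strictly drops; hence the process stops at a family in which no
-- member can be shrunk, which is exactly the minimality condition.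

open import Defs
open import Data.Nat using (ℕ; NonZero; _≤_; _<_; z≤n; s≤s)
open import Data.Nat.Properties using (≤-trans; ≰⇒>; _≤?_; +-mono-≤; +-mono-<-≤; +-mono-≤-<)
open import Data.Nat.Induction using (<-wellFounded)
open import Data.Nat.ListAction using (sum)
open import Data.Bool.Properties using () renaming (_≟_ to _≟ᵇ_)
open import Data.Fin.Subset using (Subset; _⊆_; _∩_; ∣_∣; inside; outside)
open import Data.Fin.Subset.Properties using (_⊆?_; anySubset?; p⊆q⇒∣p∣≤∣q∣; drop-∷-⊆; p∩q⊆p; ∩-idem; ∩-comm; ⊆-refl; ⊆-trans)
open import Data.List using ([]; _∷_; map)
open import Data.List.Properties using (map-∘)
open import Data.List.Relation.Unary.All using (All; all?) renaming (lookup to lookupAll)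
open import Data.List.Relation.Unary.All.Properties using (¬All⇒Any¬)
open import Data.List.Relation.Unary.Any using (any?; here; there)
open import Data.List.Membership.Propositional using (_∈_; find; lose)
open import Data.List.Membership.Propositional.Properties using (∈-map⁺; ∈-map⁻)
open import Data.Product using (_×_; Σ-syntax; ∃-syntax; _,_)
open import Data.Sum using (_⊎_; inj₁; inj₂)
open import Data.Vec using ([]; _∷_)
open import Data.Vec.Properties using (≡-dec)
import Data.Vec.Base as Vec
open import Function using (_∘_; id)
open import Induction.WellFounded using (Acc; acc)
open import Relation.Binary.Definitions using (DecidableEquality)
open import Relation.Binary.PropositionalEquality using (_≡_; refl; sym; cong; subst)
open import Relation.Nullary using (Dec; yes; no; contradiction)
open import Relation.Nullary.Decidable using (_×-dec_; ¬?)

sum-map-mono-≤ : ∀ {A : Set} {g h : A → ℕ} → (∀ x → g x ≤ h x) →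
                 ∀ xs → sum (map g xs) ≤ sum (map h xs)
sum-map-mono-≤ g≤h []       = z≤n
sum-map-mono-≤ g≤h (x ∷ xs) = +-mono-≤ (g≤h x) (sum-map-mono-≤ g≤h xs)

sum-map-mono-< : ∀ {A : Set} {g h : A → ℕ} {x xs} → (∀ y → g y ≤ h y) →
                 x ∈ xs → g x < h x → sum (map g xs) < sum (map h xs)
sum-map-mono-< {xs = _ ∷ xs} g≤h (here refl) gx<hx = +-mono-<-≤ gx<hx (sum-map-mono-≤ g≤h xs)
sum-map-mono-< {x = x} {y ∷ _} g≤h (there x∈xs) gx<hx = +-mono-≤-< (g≤h y) (sum-map-mono-< g≤h x∈xs gx<hx)

p⊊q⇒∣p∣<∣q∣ : ∀ {m} {p q : Subset m} → p ⊊ q → ∣ p ∣ < ∣ q ∣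
p⊊q⇒∣p∣<∣q∣ {p = []}          {[]}          (_ , p≢q)   = contradiction refl p≢q
p⊊q⇒∣p∣<∣q∣ {p = outside ∷ p} {outside ∷ q} (p⊆q , p≢q) =
  p⊊q⇒∣p∣<∣q∣ (drop-∷-⊆ p⊆q , p≢q ∘ cong (outside ∷_))
p⊊q⇒∣p∣<∣q∣ {p = outside ∷ p} {inside ∷ q}  (p⊆q , _)   = s≤s (p⊆q⇒∣p∣≤∣q∣ (drop-∷-⊆ p⊆q))
p⊊q⇒∣p∣<∣q∣ {p = inside ∷ p}  {outside ∷ q} (p⊆q , _)   = contradiction (p⊆q Vec.here) λ ()
p⊊q⇒∣p∣<∣q∣ {p = inside ∷ p}  {inside ∷ q}  (p⊆q , p≢q) =
  s≤s (p⊊q⇒∣p∣<∣q∣ (drop-∷-⊆ p⊆q , p≢q ∘ cong (inside ∷_)))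

module _ {n : ℕ} where

  _≟_ : DecidableEquality (Subset n)
  _≟_ = ≡-dec _≟ᵇ_

  _⊊?_ : (p q : Subset n) → Dec (p ⊊ q)
  p ⊊? q = (p ⊆? q) ×-dec ¬? (p ≟ q)

  weight : Family n → ℕ
  weight 𝒯 = sum (map ∣_∣ 𝒯)

  MeetsAll : ℕ → Family n → Subset n → Set
  MeetsAll t 𝒯 X = All (λ T → t ≤ ∣ X ∩ T ∣) 𝒯

  IsMinimal : ℕ → Family n → Set
  IsMinimal t 𝒯 = ∀ {T X} → T ∈ 𝒯 → X ⊊ T → ∃[ T′ ] (T′ ∈ 𝒯 × ∣ X ∩ T′ ∣ < t)

  Shrinkable : ℕ → Family n → Set
  Shrinkable t 𝒯 = ∃[ T ] ∃[ X ] (T ∈ 𝒯 × X ⊊ T × MeetsAll t 𝒯 X)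

  minimal⊎shrinkable : ∀ t 𝒯 → IsMinimal t 𝒯 ⊎ Shrinkable t 𝒯
  minimal⊎shrinkable t 𝒯
    with any? (λ T → anySubset? (λ X → (X ⊊? T) ×-dec all? (λ T′ → t ≤? ∣ X ∩ T′ ∣) 𝒯)) 𝒯
  ... | yes shrink = let T , T∈𝒯 , X , X⊊T , meets = find shrink in inj₂ (T , X , T∈𝒯 , X⊊T , meets)
  ... | no ¬shrink = inj₁ minimal
    where
    minimal : IsMinimal t 𝒯
    minimal {T} {X} T∈𝒯 X⊊T with all? (λ T′ → t ≤? ∣ X ∩ T′ ∣) 𝒯
    ... | yes meets = contradiction (lose T∈𝒯 (X , X⊊T , meets)) ¬shrink
    ... | no ¬meets =
      let T′ , T′∈𝒯 , small = find (¬All⇒Any¬ (λ T′ → t ≤? ∣ X ∩ T′ ∣) 𝒯 ¬meets)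
      in T′ , T′∈𝒯 , ≰⇒> small

  module _ {f : Subset n → Subset n} (f-shrinks : ∀ F → f F ⊆ F) where

    map-shrinking-sizeAtMost : ∀ {p 𝒯} → AllOfSizeAtMost p 𝒯 → AllOfSizeAtMost p (map f 𝒯)
    map-shrinking-sizeAtMost small F′∈f𝒯 with ∈-map⁻ f F′∈f𝒯
    ... | F , F∈𝒯 , refl = ≤-trans (p⊆q⇒∣p∣≤∣q∣ (f-shrinks F)) (small F∈𝒯)

    map-shrinking-subTrace : ∀ 𝒜 𝒯 → SubTrace 𝒜 𝒯 (map f 𝒯)
    map-shrinking-subTrace 𝒜 𝒯 (A∈𝒜 , S , S∈𝒯 , S⊆A) =
      A∈𝒜 , f S , ∈-map⁺ f S∈𝒯 , ⊆-trans (f-shrinks S) S⊆A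

    map-shrinking-weight-< : ∀ {T 𝒯} → T ∈ 𝒯 → f T ⊊ T → weight (map f 𝒯) < weight 𝒯
    map-shrinking-weight-< {T} {𝒯} T∈𝒯 fT⊊T =
      subst (_< weight 𝒯) (cong sum (map-∘ 𝒯))
        (sum-map-mono-< (λ F → p⊆q⇒∣p∣≤∣q∣ (f-shrinks F)) T∈𝒯 (p⊊q⇒∣p∣<∣q∣ fT⊊T))

  replace : Subset n → Subset n → Subset n → Subset n
  replace T X F with F ≟ T
  ... | yes _ = X
  ... | no  _ = F

  replace-shrinks : ∀ {T X} → X ⊆ T → ∀ F → replace T X F ⊆ F
  replace-shrinks {T} X⊆T F with F ≟ T
  ... | yes refl = X⊆T
  ... | no  _    = ⊆-refl

  replace-target : ∀ T X → replace T X T ≡ X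
  replace-target T X with T ≟ T
  ... | yes _   = refl
  ... | no  T≢T = contradiction refl T≢T

  ∈-map-replace : ∀ {T X F′ 𝒯} → F′ ∈ map (replace T X) 𝒯 → F′ ≡ X ⊎ F′ ∈ 𝒯
  ∈-map-replace {T} {X} F′∈𝒯′ with ∈-map⁻ (replace T X) F′∈𝒯′
  ... | F , F∈𝒯 , refl with F ≟ T
  ...   | yes _ = inj₁ refl
  ...   | no  _ = inj₂ F∈𝒯

  tIntersecting-∷ : ∀ {t 𝒯 X} → IsTIntersecting t 𝒯 → MeetsAll t 𝒯 X → t ≤ ∣ X ∣ →
                    IsTIntersecting t (X ∷ 𝒯)
  tIntersecting-∷ {t} {X = X} _ _ t≤∣X∣ (here refl) (here refl) =
    subst (λ Y → t ≤ ∣ Y ∣) (sym (∩-idem X)) t≤∣X∣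
  tIntersecting-∷ _ meets _ (here refl) (there G∈𝒯) = lookupAll meets G∈𝒯
  tIntersecting-∷ {t} {X = X} _ meets _ (there F∈𝒯) (here refl) =
    subst (λ Y → t ≤ ∣ Y ∣) (∩-comm X _) (lookupAll meets F∈𝒯)
  tIntersecting-∷ inter _ _ (there F∈𝒯) (there G∈𝒯) = inter F∈𝒯 G∈𝒯

  module _ (p t : ℕ) (𝒜 : Family n) where

    Refines : Family n → Family n → Set
    Refines 𝒮 𝒯 = IsTIntersecting t 𝒯 × AllOfSizeAtMost p 𝒯 × SubTrace 𝒜 𝒮 𝒯

    shrink : ∀ {𝒯} → IsTIntersecting t 𝒯 → AllOfSizeAtMost p 𝒯 → ((T , X , _) : Shrinkable t 𝒯) →
             let 𝒯′ = map (replace T X) 𝒯 in Refines 𝒯 𝒯′ × weight 𝒯′ < weight 𝒯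
    shrink {𝒯} inter small (T , X , T∈𝒯 , X⊊T@(X⊆T , _) , meets) =
      ( (λ F∈𝒯′ G∈𝒯′ → tIntersecting-∷ inter meets t≤∣X∣ (∈-X∷𝒯 F∈𝒯′) (∈-X∷𝒯 G∈𝒯′))
      , map-shrinking-sizeAtMost shrinks small
      , map-shrinking-subTrace shrinks 𝒜 𝒯 ) ,
      map-shrinking-weight-< shrinks T∈𝒯 (subst (_⊊ T) (sym (replace-target T X)) X⊊T)
      where
      shrinks : ∀ F → replace T X F ⊆ F
      shrinks = replace-shrinks X⊆T
      t≤∣X∣ : t ≤ ∣ X ∣
      t≤∣X∣ = ≤-trans (lookupAll meets T∈𝒯) (p⊆q⇒∣p∣≤∣q∣ (p∩q⊆p X T))
      ∈-X∷𝒯 : ∀ {F′} → F′ ∈ map (replace T X) 𝒯 → F′ ∈ X ∷ 𝒯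
      ∈-X∷𝒯 F′∈𝒯′ with ∈-map-replace F′∈𝒯′
      ... | inj₁ refl = here refl
      ... | inj₂ F′∈𝒯 = there F′∈𝒯

    minimise : ∀ 𝒮 → Acc _<_ (weight 𝒮) → IsTIntersecting t 𝒮 → AllOfSizeAtMost p 𝒮 →
               Σ[ 𝒯 ∈ Family n ] (Refines 𝒮 𝒯 × IsMinimal t 𝒯)
    minimise 𝒮 (acc rec) inter small with minimal⊎shrinkable t 𝒮
    ... | inj₁ minimal = 𝒮 , (inter , small , id) , minimal
    ... | inj₂ shrinkable =
      let (inter′ , small′ , trace′) , lighter = shrink inter small shrinkable
          𝒯 , (inter″ , small″ , trace″) , minimal = minimise _ (rec lighter) inter′ small′
      in 𝒯 , (inter″ , small″ , trace″ ∘ trace′) , minimal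

mainTheorem13 : (n p t : ℕ) → .{{NonZero n}} → .{{NonZero p}} → .{{NonZero t}} →
    (𝒜 𝒮 : Family n) → IsTIntersecting t 𝒮 → AllOfSizeAtMost p 𝒮 →
    Σ[ 𝒯 ∈ Family n ] (IsTIntersecting t 𝒯 × AllOfSizeAtMost p 𝒯 × SubTrace 𝒜 𝒮 𝒯 ×
    (∀ {T X} → T ∈ 𝒯 → X ⊊ T → ∃[ T′ ] (T′ ∈ 𝒯 × ∣ X ∩ T′ ∣ < t)))
mainTheorem13 n p t 𝒜 𝒮 inter small =
  let 𝒯 , (inter′ , small′ , trace) , minimal = minimise p t 𝒜 𝒮 (<-wellFounded _) inter small
  in 𝒯 , inter′ , small′ , trace , minimal
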